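{- Let $q$ be an odd prime power, $n$ an odd positive integer, and $1\neq\sigma\in\mathrm{Aut}(\mathbb F_q)$. Then there exists $M\in M_{n+1}(q)$ such that $\theta_M=0$.
   Context: $V^*=\mathbb F_q^{n+1}$ (row vectors), $V=\mathbb F_q^{n+1}$ (column vectors); $\xi^\sigma$ is $\xi$ with $\sigma$ applied coordinatewise. $\theta_M$ is the number of points $[\xi]\in\mathrm{PG}(V^*)$ such that $\ker(\xi^\sigma)\subseteq\ker(\xi M)$, where $\ker\eta=\{x\in V:\eta x=0\}$. -}

module Defs where

open import Level using (_⊔_)
open import Algebra.Bundles using (CommutativeRing)
open import Data.Nat using (ℕ; zero; suc)
open import Data.Fin using (Fin; zero; suc)
open import Data.Product using (Σ; ∃; _×_; _,_)
open import Relation.Nullary using (¬_)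
open import Relation.Binary.PropositionalEquality using (_≡_)

module _ {c ℓ} (F : CommutativeRing c ℓ) where
  open CommutativeRing F hiding (zero)

  IsField : Set (c ⊔ ℓ)
  IsField = (¬ (0# ≈ 1#)) × (∀ x → ¬ (x ≈ 0#) → Σ Carrier λ y → (x * y) ≈ 1#)

  HasCardinality : ℕ → Set (c ⊔ ℓ)
  HasCardinality q =
    Σ (Fin q → Carrier) λ e →
      (∀ i j → e i ≈ e j → i ≡ j) × (∀ x → Σ (Fin q) λ i → e i ≈ x)

  record Automorphism : Set (c ⊔ ℓ) where
    field
      σ       : Carrier → Carrier
      σ-cong  : ∀ {x y} → x ≈ y → σ x ≈ σ y
      σ-+     : ∀ x y → σ (x + y) ≈ (σ x + σ y)
      σ-*     : ∀ x y → σ (x * y) ≈ (σ x * σ y)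
      σ-1     : σ 1# ≈ 1#
      σ-inj   : ∀ {x y} → σ x ≈ σ y → x ≈ y
      σ-surj  : ∀ y → Σ Carrier λ x → σ x ≈ y

  NonTrivial : Automorphism → Set (c ⊔ ℓ)
  NonTrivial a = Σ Carrier λ x → ¬ (Automorphism.σ a x ≈ x)

  ∑ : ∀ m → (Fin m → Carrier) → Carrier
  ∑ zero    f = 0#
  ∑ (suc m) f = f zero + ∑ m (λ i → f (suc i))

  -- row vectors (V*), column vectors (V), and (m×m) matrices over F, m = n+1
  Vec* : ℕ → Set c
  Vec* m = Fin m → Carrier

  Mat : ℕ → Set c
  Mat m = Fin m → Fin m → Carrier

  apply : ∀ {m} → Vec* m → (Fin m → Carrier) → Carrier
  apply {m} η x = ∑ m (λ i → η i * x i)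

  rowMul : ∀ {m} → Vec* m → Mat m → Vec* m
  rowMul {m} ξ M j = ∑ m (λ i → ξ i * M i j)

  frob : ∀ {m} → Automorphism → Vec* m → Vec* m
  frob a ξ i = Automorphism.σ a (ξ i)

  NonZeroVec : ∀ {m} → Vec* m → Set ℓ
  NonZeroVec {m} ξ = ¬ (∀ i → ξ i ≈ 0#)

  KerIncl : ∀ {m} → Automorphism → Mat m → Vec* m → Set (c ⊔ ℓ)
  KerIncl a M ξ = ∀ x → apply (frob a ξ) x ≈ 0# → apply (rowMul ξ M) x ≈ 0#

  -- θ_M = 0: no projective point [ξ] (ξ ≠ 0) satisfies ker(ξ^σ) ⊆ ker(ξM).
  θ-zero : ∀ {m} → Automorphism → Mat m → Set (c ⊔ ℓ)
  θ-zero a M = ∀ ξ → NonZeroVec ξ → ¬ KerIncl a M ξ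

{-# OPTIONS --safe #-}
module Submission where

open import Defs
open import Algebra.Bundles using (CommutativeRing)
open import Data.Nat as ℕ using (ℕ; zero; suc; _^_; _%_; _/_; _∸_)
import Data.Nat.Properties as ℕ
open import Data.Nat.Properties using (even≢odd; m+[n∸m]≡n; n<1+n)
open import Data.Nat.DivMod using (m≡m%n+[m/n]*n)
open import Data.Nat.Primality using (Prime)
open import Data.Fin as Fin using (Fin; zero; suc; toℕ; opposite; punchIn; punchOut)
open import Data.Fin.Properties
  using (any?; all?; ¬∀⟶∃¬; <-cmp; <-asym; _<?_; <⇒notInjective; punchInᵢ≢i;
         punchOut-injective; opposite-prop; opposite-involutive; toℕ≤pred[n])
open import Data.Fin.Permutation using (Permutation; permutation)
open import Data.Vec.Functional using (removeAt; replicate)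
open import Data.Product using (Σ; ∃; _×_; _,_; proj₁; proj₂)
open import Data.Sum using (_⊎_; inj₁; inj₂)
open import Function.Definitions using (Injective)
open import Relation.Nullary using (¬_; Dec; yes; no; contradiction)
open import Relation.Nullary.Decidable using (map′)
open import Relation.Binary.Definitions using (Decidable; tri<; tri≈; tri>)
open import Relation.Binary.PropositionalEquality as ≡ using (_≡_; _≢_)

-- Write N x = x σ(x).  N is multiplicative and N 1 = N (-1) = 1, where 1 ≠ -1 because
-- q is odd; so N is not injective, hence not surjective, on the finite field: some c
-- is not of the form N w.  Since n + 1 is even, i ↦ n - i pairs off the coordinates;
-- M is the anti-diagonal matrix carrying c on one entry of each pair and 1 on the
-- other.  If ker(ξ^σ) ⊆ ker(ξM) and ξ_p ≠ 0, evaluating on σ(ξ_p') e_p - σ(ξ_p) e_p'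
-- (p' the partner of p) yields c N u = N w for {u, w} = {ξ_p, ξ_p'}, which forces
-- ξ_p = 0.

m%2≡1⇒m≡1+2*[m/2] : ∀ {m} → m % 2 ≡ 1 → m ≡ suc (2 ℕ.* (m / 2))
m%2≡1⇒m≡1+2*[m/2] {m} m-odd = ≡.trans (m≡m%n+[m/n]*n m 2)
  (≡.cong₂ ℕ._+_ m-odd (ℕ.*-comm (m / 2) 2))

opposite-fixfree : ∀ {n} → n % 2 ≡ 1 → (i : Fin (suc n)) → opposite i ≢ i
opposite-fixfree {n} n-odd i opp-i≡i = even≢odd (toℕ i) (n / 2) (begin
  2 ℕ.* toℕ i           ≡⟨ ≡.cong (toℕ i ℕ.+_) (ℕ.+-identityʳ (toℕ i)) ⟩
  toℕ i ℕ.+ toℕ i        ≡⟨ ≡.cong (toℕ i ℕ.+_) i≡n∸i ⟩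
  toℕ i ℕ.+ (n ∸ toℕ i)  ≡⟨ m+[n∸m]≡n (toℕ≤pred[n] i) ⟩
  n                      ≡⟨ m%2≡1⇒m≡1+2*[m/2] n-odd ⟩
  suc (2 ℕ.* (n / 2))    ∎)
  where
  open ≡.≡-Reasoning
  i≡n∸i : toℕ i ≡ n ∸ toℕ i
  i≡n∸i = ≡.trans (≡.cong toℕ (≡.sym opp-i≡i)) (opposite-prop i)

injective⇒surjective : ∀ {n} {g : Fin n → Fin n} → Injective _≡_ _≡_ g → ∀ v → ∃ λ u → g u ≡ v
injective⇒surjective {suc n} {g} g-injective v with any? (λ u → g u Fin.≟ v)
... | yes hit = hit
... | no  miss =
  contradiction (λ {u} {u′} eq → g-injective (punchOut-injective (g≢v u) (g≢v u′) eq))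
                (<⇒notInjective {f = λ u → punchOut (g≢v u)} (n<1+n n))
  where
  g≢v : ∀ u → v ≢ g u
  g≢v u v≡gu = miss (u , ≡.sym v≡gu)

surjective⇒injective : ∀ {n} {h : Fin n → Fin n} → (∀ v → ∃ λ u → h u ≡ v) → Injective _≡_ _≡_ h
surjective⇒injective {n} {h} h-surjective {u} {u′} hu≡hu′ = begin
  u         ≡⟨ g∘h≗id u ⟨
  g (h u)   ≡⟨ ≡.cong g hu≡hu′ ⟩
  g (h u′)  ≡⟨ g∘h≗id u′ ⟩
  u′        ∎
  where
  open ≡.≡-Reasoning
  g : Fin n → Fin n
  g v = proj₁ (h-surjective v)
  h∘g≗id : ∀ v → h (g v) ≡ v
  h∘g≗id v = proj₂ (h-surjective v)
  g-injective : Injective _≡_ _≡_ g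
  g-injective {v} {v′} gv≡gv′ =
    ≡.trans (≡.sym (h∘g≗id v)) (≡.trans (≡.cong h gv≡gv′) (h∘g≗id v′))
  g∘h≗id : ∀ u → g (h u) ≡ u
  g∘h≗id u with v , gv≡u ← injective⇒surjective g-injective u =
    ≡.trans (≡.cong g (≡.trans (≡.cong h (≡.sym gv≡u)) (h∘g≗id v))) gv≡u

module Summation {r ℓ} (R : CommutativeRing r ℓ) where
  open CommutativeRing R hiding (zero)
  open import Algebra.Properties.Semiring.Sum semiring
    using (sum; sum-remove; sum-cong-≋; sum-replicate-zero; ∑-distrib-+)
  open import Relation.Binary.Reasoning.Setoid setoid

  ∑≡sum : ∀ m (f : Fin m → Carrier) → ∑ R m f ≡ sum f
  ∑≡sum zero    f = ≡.refl
  ∑≡sum (suc m) f = ≡.cong (f zero +_) (∑≡sum m (λ i → f (suc i)))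

  sum-supported : ∀ {m} (f : Fin m → Carrier) p → (∀ i → i ≢ p → f i ≈ 0#) → sum f ≈ f p
  sum-supported {suc m} f p f≈0 = begin
    sum f                       ≈⟨ sum-remove {i = p} f ⟩
    f p + sum (removeAt f p)    ≈⟨ +-congˡ (sum-cong-≋ (λ k → f≈0 (punchIn p k) (punchInᵢ≢i p k))) ⟩
    f p + sum (replicate m 0#)  ≈⟨ +-congˡ (sum-replicate-zero m) ⟩
    f p + 0#                    ≈⟨ +-identityʳ (f p) ⟩
    f p                         ∎

  single : ∀ {m} → Fin m → Carrier → Fin m → Carrier
  single p u i with i Fin.≟ p
  ... | yes _ = u
  ... | no  _ = 0#

  single-at : ∀ {m} (p : Fin m) u → single p u p ≡ u
  single-at p u with p Fin.≟ p
  ... | yes _   = ≡.refl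
  ... | no  p≢p = contradiction ≡.refl p≢p

  single-off : ∀ {m} {p i : Fin m} u → i ≢ p → single p u i ≡ 0#
  single-off {p = p} {i} u i≢p with i Fin.≟ p
  ... | yes i≡p = contradiction i≡p i≢p
  ... | no  _   = ≡.refl

  apply-single : ∀ {m} (η : Vec* R m) p u → apply R η (single p u) ≈ η p * u
  apply-single {m} η p u = begin
    apply R η (single p u)          ≡⟨ ∑≡sum m _ ⟩
    sum (λ i → η i * single p u i)  ≈⟨ sum-supported _ p off-support ⟩
    η p * single p u p              ≡⟨ ≡.cong (η p *_) (single-at p u) ⟩
    η p * u                         ∎
    where
    off-support : ∀ i → i ≢ p → η i * single p u i ≈ 0#
    off-support i i≢p = trans (*-congˡ (reflexive (single-off u i≢p))) (zeroʳ (η i))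

  apply-+ : ∀ {m} (η x y : Vec* R m) → apply R η (λ i → x i + y i) ≈ apply R η x + apply R η y
  apply-+ {m} η x y = begin
    apply R η (λ i → x i + y i)        ≡⟨ ∑≡sum m _ ⟩
    sum (λ i → η i * (x i + y i))      ≈⟨ sum-cong-≋ (λ i → distribˡ (η i) (x i) (y i)) ⟩
    sum (λ i → η i * x i + η i * y i)  ≈⟨ ∑-distrib-+ (λ i → η i * x i) (λ i → η i * y i) ⟩
    sum (λ i → η i * x i) + sum (λ i → η i * y i)
      ≡⟨ ≡.cong₂ _+_ (∑≡sum m _) (∑≡sum m _) ⟨
    apply R η x + apply R η y          ∎

module FiniteRing {r ℓ} (R : CommutativeRing r ℓ) {q} (card : HasCardinality R q) where
  open CommutativeRing R hiding (zero)
  open import Algebra.Properties.Ring ring using (+-identityʳ-unique)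
  open import Algebra.Properties.Semiring.Mult semiring using (×1-homo-*) renaming (_×_ to _·_)
  open import Algebra.Properties.Semiring.Sum semiring
    using (sum; sum-permute; sum-cong-≋; sum-replicate; ∑-distrib-+)
  open import Relation.Binary.Reasoning.Setoid setoid

  private
    enum : Fin q → Carrier
    enum = proj₁ card

    enum-injective : ∀ i j → enum i ≈ enum j → i ≡ j
    enum-injective = proj₁ (proj₂ card)

    index : Carrier → Fin q
    index x = proj₁ (proj₂ (proj₂ card) x)

    enum-index : ∀ x → enum (index x) ≈ x
    enum-index x = proj₂ (proj₂ (proj₂ card) x)

    index-enum : ∀ i → index (enum i) ≡ i
    index-enum i = enum-injective _ _ (enum-index (enum i))

    index-cong : ∀ {x y} → x ≈ y → index x ≡ index y
    index-cong {x} {y} x≈y = enum-injective _ _ (trans (enum-index x) (trans x≈y (sym (enum-index y))))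

    index-injective : ∀ {x y} → index x ≡ index y → x ≈ y
    index-injective {x} {y} ix≡iy =
      trans (sym (enum-index x)) (trans (reflexive (≡.cong enum ix≡iy)) (enum-index y))

  _≈?_ : Decidable _≈_
  x ≈? y = map′ index-injective index-cong (index x Fin.≟ index y)

  private
    image? : (f : Carrier → Carrier) → ∀ y → Dec (∃ λ i → f (enum i) ≈ y)
    image? f y = any? (λ i → f (enum i) ≈? y)

  translate : Carrier → Fin q → Fin q
  translate a i = index (enum i + a)

  translate-cancel : ∀ {a b} → a + b ≈ 0# → ∀ i → translate b (translate a i) ≡ i
  translate-cancel {a} {b} a+b≈0 i = enum-injective _ _ (begin
    enum (translate b (translate a i))  ≈⟨ enum-index _ ⟩
    enum (translate a i) + b            ≈⟨ +-congʳ (enum-index _) ⟩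
    (enum i + a) + b                    ≈⟨ +-assoc _ a b ⟩
    enum i + (a + b)                    ≈⟨ +-congˡ a+b≈0 ⟩
    enum i + 0#                         ≈⟨ +-identityʳ _ ⟩
    enum i                              ∎)

  translation : Carrier → Permutation q q
  translation a = permutation (translate a) (translate (- a))
    (translate-cancel (-‿inverseˡ a)) (translate-cancel (-‿inverseʳ a))

  -- Translating by 1 permutes the elements, so their sum S satisfies S = S + q·1.
  card·1≈0 : q · 1# ≈ 0#
  card·1≈0 = +-identityʳ-unique (sum enum) (q · 1#) (sym (begin
    sum enum                         ≈⟨ sum-permute enum (translation 1#) ⟩
    sum (λ i → enum (translate 1# i))  ≈⟨ sum-cong-≋ (λ i → enum-index (enum i + 1#)) ⟩
    sum (λ i → enum i + 1#)          ≈⟨ ∑-distrib-+ enum (λ _ → 1#) ⟩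
    sum enum + sum (replicate q 1#)  ≈⟨ +-congˡ (sum-replicate q) ⟩
    sum enum + q · 1#                ∎))

  odd-card⇒1≉-1 : q % 2 ≡ 1 → ¬ 0# ≈ 1# → ¬ 1# ≈ - 1#
  odd-card⇒1≉-1 q-odd 0≉1 1≈-1 = 0≉1 (begin
    0#                           ≈⟨ card·1≈0 ⟨
    q · 1#                       ≡⟨ ≡.cong (_· 1#) (m%2≡1⇒m≡1+2*[m/2] {q} q-odd) ⟩
    1# + (2 ℕ.* k) · 1#          ≈⟨ +-congˡ (×1-homo-* 2 k) ⟩
    1# + (2 · 1#) * (k · 1#)     ≈⟨ +-congˡ (*-congʳ 2·1≈0) ⟩
    1# + 0# * (k · 1#)           ≈⟨ +-congˡ (zeroˡ _) ⟩
    1# + 0#                      ≈⟨ +-identityʳ 1# ⟩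
    1#                           ∎)
    where
    k : ℕ
    k = q / 2
    2·1≈0 : 2 · 1# ≈ 0#
    2·1≈0 = begin
      1# + (1# + 0#)  ≈⟨ +-congˡ (+-identityʳ 1#) ⟩
      1# + 1#         ≈⟨ +-congˡ 1≈-1 ⟩
      1# - 1#         ≈⟨ -‿inverseʳ 1# ⟩
      0#              ∎

  surjective⇒injective-≈ : ∀ {f : Carrier → Carrier} → (∀ {x y} → x ≈ y → f x ≈ f y) →
                           (∀ y → ∃ λ x → f x ≈ y) → ∀ {x y} → f x ≈ f y → x ≈ y
  surjective⇒injective-≈ {f} f-cong f-surjective {x} {y} fx≈fy =
    index-injective (surjective⇒injective h-surjective (index-cong fx′≈fy′))
    where
    h : Fin q → Fin q
    h i = index (f (enum i))
    h-surjective : ∀ j → ∃ λ i → h i ≡ j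
    h-surjective j with x , fx≈ej ← f-surjective (enum j) =
      index x , ≡.trans (index-cong (trans (f-cong (enum-index x)) fx≈ej)) (index-enum j)
    fx′≈fy′ : f (enum (index x)) ≈ f (enum (index y))
    fx′≈fy′ = trans (f-cong (enum-index x)) (trans fx≈fy (sym (f-cong (enum-index y))))

  nonInjective⇒∃-missed : ∀ {f : Carrier → Carrier} → (∀ {x y} → x ≈ y → f x ≈ f y) →
                          ∀ {x y} → f x ≈ f y → ¬ x ≈ y → ∃ λ c → ∀ w → ¬ f w ≈ c
  nonInjective⇒∃-missed {f} f-cong fx≈fy x≉y with all? (λ j → image? f (enum j))
  ... | yes onto = contradiction (surjective⇒injective-≈ f-cong f-surjective fx≈fy) x≉y
    where
    f-surjective : ∀ y → ∃ λ x → f x ≈ y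
    f-surjective y with i , fi≈y′ ← onto (index y) = enum i , trans fi≈y′ (enum-index y)
  ... | no ¬onto with j , j-missed ← ¬∀⟶∃¬ q _ (λ j → image? f (enum j)) ¬onto =
    enum j , λ w fw≈ej → j-missed (index w , trans (f-cong (enum-index w)) fw≈ej)

module Norm {r ℓ} (F : CommutativeRing r ℓ) (A : Automorphism F) where
  open CommutativeRing F hiding (zero)
  open Automorphism A
  open import Algebra.Properties.Ring ring using (x+x≈x⇒x≈0; +-inverseʳ-unique; -1*x≈-x; -‿involutive)
  open import Algebra.Solver.CommutativeMonoid *-commutativeMonoid using (solve; _⊕_; _⊜_)
  open import Relation.Binary.Reasoning.Setoid setoid

  σ-0 : σ 0# ≈ 0#
  σ-0 = x+x≈x⇒x≈0 (σ 0#) (trans (sym (σ-+ 0# 0#)) (σ-cong (+-identityʳ 0#)))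

  σ-‿ : ∀ x → σ (- x) ≈ - σ x
  σ-‿ x = +-inverseʳ-unique (σ x) (σ (- x)) (begin
    σ x + σ (- x)  ≈⟨ σ-+ x (- x) ⟨
    σ (x - x)      ≈⟨ σ-cong (-‿inverseʳ x) ⟩
    σ 0#           ≈⟨ σ-0 ⟩
    0#             ∎)

  N : Carrier → Carrier
  N x = x * σ x

  N-cong : ∀ {x y} → x ≈ y → N x ≈ N y
  N-cong x≈y = *-cong x≈y (σ-cong x≈y)

  N-* : ∀ x y → N (x * y) ≈ N x * N y
  N-* x y = begin
    (x * y) * σ (x * y)    ≈⟨ *-congˡ (σ-* x y) ⟩
    (x * y) * (σ x * σ y)
      ≈⟨ solve 4 (λ x y u v → (x ⊕ y) ⊕ (u ⊕ v) ⊜ (x ⊕ u) ⊕ (y ⊕ v)) refl x y (σ x) (σ y) ⟩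
    (x * σ x) * (y * σ y)  ∎

  N-1 : N 1# ≈ 1#
  N-1 = trans (*-congˡ σ-1) (*-identityˡ 1#)

  N-‿1 : N (- 1#) ≈ 1#
  N-‿1 = begin
    - 1# * σ (- 1#)  ≈⟨ *-congˡ (trans (σ-‿ 1#) (-‿cong σ-1)) ⟩
    - 1# * - 1#      ≈⟨ -1*x≈-x (- 1#) ⟩
    - - 1#           ≈⟨ -‿involutive 1# ⟩
    1#               ∎

  *-N : ∀ x y → (x * y) * σ x ≈ y * N x
  *-N x y = solve 3 (λ x y u → (x ⊕ y) ⊕ u ⊜ y ⊕ (x ⊕ u)) refl x y (σ x)

module AntiDiagonal {r ℓ} (F : CommutativeRing r ℓ) {m} (π : Fin m → Fin m)
  (π-involutive : ∀ i → π (π i) ≡ i) (π-fixfree : ∀ i → π i ≢ i)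
  (c : CommutativeRing.Carrier F) where
  open CommutativeRing F hiding (zero)
  open Summation F using (single; apply-single)

  weight : Fin m → Carrier
  weight j with j <? π j
  ... | yes _ = c
  ... | no  _ = 1#

  weight-< : ∀ {j} → j Fin.< π j → weight j ≡ c
  weight-< {j} j<πj with j <? π j
  ... | yes _   = ≡.refl
  ... | no  j≮πj = contradiction j<πj j≮πj

  weight-≮ : ∀ {j} → ¬ j Fin.< π j → weight j ≡ 1#
  weight-≮ {j} j≮πj with j <? π j
  ... | yes j<πj = contradiction j<πj j≮πj
  ... | no  _    = ≡.refl

  weight-pair : ∀ p → (weight p ≡ c × weight (π p) ≡ 1#) ⊎ (weight p ≡ 1# × weight (π p) ≡ c)
  weight-pair p with <-cmp p (π p)
  ... | tri< p<πp _ _ = inj₁ (weight-< p<πp , weight-≮ (λ πp<ππp → <-asym p<πp (πp<ππp⇒πp<p πp<ππp)))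
    where
    πp<ππp⇒πp<p : π p Fin.< π (π p) → π p Fin.< p
    πp<ππp⇒πp<p = ≡.subst (π p Fin.<_) (π-involutive p)
  ... | tri≈ _ p≡πp _ = contradiction (≡.sym p≡πp) (π-fixfree p)
  ... | tri> _ _ πp<p = inj₂ (weight-≮ (<-asym πp<p) , weight-< (πp<p⇒πp<ππp πp<p))
    where
    πp<p⇒πp<ππp : π p Fin.< p → π p Fin.< π (π p)
    πp<p⇒πp<ππp = ≡.subst (π p Fin.<_) (≡.sym (π-involutive p))

  antiDiagonal : Mat F m
  antiDiagonal i j = single (π j) (weight j) i

  rowMul-antiDiagonal : ∀ ξ j → rowMul F ξ antiDiagonal j ≈ ξ (π j) * weight j
  rowMul-antiDiagonal ξ j = apply-single ξ (π j) (weight j)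

module KernelInclusion {r ℓ} (F : CommutativeRing r ℓ) (isField : IsField F)
  (_≈?_ : Decidable (CommutativeRing._≈_ F)) (A : Automorphism F) where
  open CommutativeRing F hiding (zero)
  open Automorphism A
  open Norm F A
  open Summation F using (single; apply-single; apply-+)
  open import Algebra.Properties.Ring ring using (x∙y⁻¹≈ε⇒x≈y; -‿distribʳ-*)
  open import Relation.Binary.Reasoning.Setoid setoid

  *-cancelˡ-nonzero : ∀ {x y} → ¬ x ≈ 0# → x * y ≈ 0# → y ≈ 0#
  *-cancelˡ-nonzero {x} {y} x≉0 xy≈0 with x⁻¹ , xx⁻¹≈1 ← proj₂ isField x x≉0 = begin
    y                ≈⟨ *-identityˡ y ⟨
    1# * y           ≈⟨ *-congʳ (trans (sym xx⁻¹≈1) (*-comm x x⁻¹)) ⟩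
    (x⁻¹ * x) * y    ≈⟨ *-assoc x⁻¹ x y ⟩
    x⁻¹ * (x * y)    ≈⟨ *-congˡ xy≈0 ⟩
    x⁻¹ * 0#         ≈⟨ zeroʳ x⁻¹ ⟩
    0#               ∎

  N≈0⇒≈0 : ∀ {w} → N w ≈ 0# → w ≈ 0#
  N≈0⇒≈0 {w} Nw≈0 with w ≈? 0#
  ... | yes w≈0 = w≈0
  ... | no  w≉0 = contradiction (σ-inj (trans (*-cancelˡ-nonzero w≉0 Nw≈0) (sym σ-0))) w≉0

  nonNorm-multiple : ∀ {c} → (∀ w → ¬ N w ≈ c) → ∀ {u w} → c * N u ≈ N w → u ≈ 0# × w ≈ 0#
  nonNorm-multiple {c} c-nonNorm {u} {w} cNu≈Nw = u≈0 , N≈0⇒≈0 (begin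
    N w        ≈⟨ cNu≈Nw ⟨
    c * N u    ≈⟨ *-congˡ (N-cong u≈0) ⟩
    c * N 0#   ≈⟨ *-congˡ (zeroˡ (σ 0#)) ⟩
    c * 0#     ≈⟨ zeroʳ c ⟩
    0#         ∎)
    where
    u≈0 : u ≈ 0#
    u≈0 with u ≈? 0#
    ... | yes u≈0 = u≈0
    ... | no  u≉0 with u⁻¹ , uu⁻¹≈1 ← proj₂ isField u u≉0 = contradiction (begin
      N (w * u⁻¹)          ≈⟨ N-* w u⁻¹ ⟩
      N w * N u⁻¹          ≈⟨ *-congʳ cNu≈Nw ⟨
      (c * N u) * N u⁻¹    ≈⟨ *-assoc c (N u) (N u⁻¹) ⟩
      c * (N u * N u⁻¹)    ≈⟨ *-congˡ (N-* u u⁻¹) ⟨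
      c * N (u * u⁻¹)      ≈⟨ *-congˡ (trans (N-cong uu⁻¹≈1) N-1) ⟩
      c * 1#               ≈⟨ *-identityʳ c ⟩
      c                    ∎) (c-nonNorm (w * u⁻¹))

  module _ {m} (π : Fin m → Fin m) (π-involutive : ∀ i → π (π i) ≡ i) (π-fixfree : ∀ i → π i ≢ i)
           {c} (c-nonNorm : ∀ w → ¬ N w ≈ c) where
    open AntiDiagonal F π π-involutive π-fixfree c

    kerIncl-antiDiagonal⇒≈0 : ∀ ξ → KerIncl F A antiDiagonal ξ → ∀ p → ξ p ≈ 0#
    kerIncl-antiDiagonal⇒≈0 ξ ker⊆ p = conclude (weight-pair p)
      where
      a b : Carrier
      a = ξ p
      b = ξ (π p)
      x : Fin m → Carrier
      x i = single p (σ b) i + single (π p) (- σ a) i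

      apply-x : ∀ η → apply F η x ≈ η p * σ b + η (π p) * - σ a
      apply-x η = trans (apply-+ η _ _) (+-cong (apply-single η p (σ b)) (apply-single η (π p) (- σ a)))

      ξσx≈0 : apply F (frob F A ξ) x ≈ 0#
      ξσx≈0 = begin
        apply F (frob F A ξ) x    ≈⟨ apply-x (frob F A ξ) ⟩
        σ a * σ b + σ b * - σ a   ≈⟨ +-congˡ (-‿distribʳ-* (σ b) (σ a)) ⟨
        σ a * σ b - σ b * σ a     ≈⟨ +-congˡ (-‿cong (*-comm (σ b) (σ a))) ⟩
        σ a * σ b - σ a * σ b     ≈⟨ -‿inverseʳ (σ a * σ b) ⟩
        0#                        ∎

      ξMp≈ : rowMul F ξ antiDiagonal p ≈ b * weight p
      ξMp≈ = rowMul-antiDiagonal ξ p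

      ξMπp≈ : rowMul F ξ antiDiagonal (π p) ≈ a * weight (π p)
      ξMπp≈ = trans (rowMul-antiDiagonal ξ (π p)) (*-congʳ (reflexive (≡.cong ξ (π-involutive p))))

      balance : weight p * N b ≈ weight (π p) * N a
      balance = x∙y⁻¹≈ε⇒x≈y _ _ (begin
        weight p * N b - weight (π p) * N a
          ≈⟨ +-cong (*-N b (weight p)) (-‿cong (*-N a (weight (π p)))) ⟨
        (b * weight p) * σ b - (a * weight (π p)) * σ a
          ≈⟨ +-congˡ (-‿distribʳ-* (a * weight (π p)) (σ a)) ⟩
        (b * weight p) * σ b + (a * weight (π p)) * - σ a
          ≈⟨ +-cong (*-congʳ ξMp≈) (*-congʳ ξMπp≈) ⟨
        rowMul F ξ antiDiagonal p * σ b + rowMul F ξ antiDiagonal (π p) * - σ a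
          ≈⟨ apply-x (rowMul F ξ antiDiagonal) ⟨
        apply F (rowMul F ξ antiDiagonal) x
          ≈⟨ ker⊆ x ξσx≈0 ⟩
        0# ∎)

      conclude : (weight p ≡ c × weight (π p) ≡ 1#) ⊎ (weight p ≡ 1# × weight (π p) ≡ c) → a ≈ 0#
      conclude (inj₁ (wp≡c , wπp≡1)) = proj₂ (nonNorm-multiple c-nonNorm (begin
        c * N b               ≡⟨ ≡.cong (_* N b) wp≡c ⟨
        weight p * N b        ≈⟨ balance ⟩
        weight (π p) * N a    ≡⟨ ≡.cong (_* N a) wπp≡1 ⟩
        1# * N a              ≈⟨ *-identityˡ (N a) ⟩
        N a                   ∎))
      conclude (inj₂ (wp≡1 , wπp≡c)) = proj₁ (nonNorm-multiple c-nonNorm (begin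
        c * N a               ≡⟨ ≡.cong (_* N a) wπp≡c ⟨
        weight (π p) * N a    ≈⟨ balance ⟨
        weight p * N b        ≡⟨ ≡.cong (_* N b) wp≡1 ⟩
        1# * N b              ≈⟨ *-identityˡ (N b) ⟩
        N b                   ∎))

    θ-zero-antiDiagonal : θ-zero F A antiDiagonal
    θ-zero-antiDiagonal ξ ξ≢0 ker⊆ = ξ≢0 (kerIncl-antiDiagonal⇒≈0 ξ ker⊆)

corollary3p14 : ∀ {c ℓ} (F : CommutativeRing c ℓ) (q n : ℕ) →
    IsField F → HasCardinality F q →
    Σ ℕ (λ p → Σ ℕ (λ k → Prime p × q ≡ p ^ suc k)) → q % 2 ≡ 1 →
    n % 2 ≡ 1 →
    (σ : Automorphism F) → NonTrivial F σ →
    Σ (Mat F (suc n)) (λ M → θ-zero F σ M)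
corollary3p14 F q n isField card _ q-odd n-odd σ _ =
  antiDiagonal , θ-zero-antiDiagonal opposite opposite-involutive no-fixed-point (proj₂ nonNorm)
  where
  open CommutativeRing F using (_≈_; trans; sym)
  open FiniteRing F card using (_≈?_; odd-card⇒1≉-1; nonInjective⇒∃-missed)
  open Norm F σ using (N; N-cong; N-1; N-‿1)
  open KernelInclusion F isField _≈?_ σ using (θ-zero-antiDiagonal)

  no-fixed-point : (i : Fin (suc n)) → opposite i ≢ i
  no-fixed-point = opposite-fixfree n-odd

  nonNorm : ∃ λ c → ∀ w → ¬ N w ≈ c
  nonNorm = nonInjective⇒∃-missed N-cong (trans N-1 (sym N-‿1))
                                  (odd-card⇒1≉-1 q-odd (proj₁ isField))

  open AntiDiagonal F opposite opposite-involutive no-fixed-point (proj₁ nonNorm) using (antiDiagonal)
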